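{- Let $n\ge2$. The number of complete parking preferences $\alpha\in[n]^n$ is $(n-1)^{n-1}$.
   Context: $[n]=\{1,\dots,n\}$. For $\alpha=(a_1,\dots,a_n)\in[n]^n$ let $|\alpha|_i=|\{j:a_j=i\}|$ and $u_\alpha(j)=\sum_{i=j}^n|\alpha|_i-(n-j+1)$ for $j\in[n]$. $\alpha$ is complete if $u_\alpha(j)\ge1$ for every $j\in\{2,\dots,n\}$. -}

module Defs where

open import Data.Nat using (ℕ; zero; suc; _+_; _≤?_)
open import Data.Fin using (Fin; toℕ)
open import Data.Vec using (Vec; []; _∷_; lookup; toList)
open import Data.List using (List; []; _∷_; concatMap; map; length; filter; upTo)
open import Data.Nat.ListAction using (sum)
open import Data.Integer as ℤ using (ℤ; +_; _-_)
import Data.Integer.Properties as ℤP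
open import Data.Vec using (allFin)
open import Relation.Nullary using (Dec; yes; no)
open import Data.List.Relation.Unary.All using (All; all?)

-- Parking preference α ∈ [n]^n as a vector of length n with entries in Fin n;
-- the entry x : Fin n represents the value toℕ x + 1 ∈ [n].
Pref : ℕ → Set
Pref n = Vec (Fin n) n

count : ∀ {n m} → Vec (Fin n) m → ℕ → ℕ
count [] i = 0
count (a ∷ as) i with (suc (toℕ a)) Data.Nat.≟ i
... | yes _ = suc (count as i)
... | no _ = count as i

sumFrom : ℕ → ℕ → (ℕ → ℕ) → ℕ
sumFrom j n f = sum (map f (filter (λ i → j ≤? i) (map suc (upTo n))))

u : ∀ {n} → Pref n → ℕ → ℤ
u {n} α j = + sumFrom j n (count α) - ((+ n - + j) ℤ.+ + 1)

range2n : ℕ → List ℕ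
range2n n = filter (λ i → 2 ≤? i) (map suc (upTo n))

Complete : ∀ {n} → Pref n → Set
Complete {n} α = All (λ j → + 1 ℤ.≤ u α j) (range2n n)

complete? : ∀ {n} (α : Pref n) → Dec (Complete α)
complete? {n} α = all? (λ j → + 1 ℤ.≤? u α j) (range2n n)

allVecs : (n m : ℕ) → List (Vec (Fin n) m)
allVecs n zero = [] ∷ []
allVecs n (suc m) = concatMap (λ a → map (a ∷_) (allVecs n m)) (toList (allFin n))

numComplete : ℕ → ℕ
numComplete n = length (filter complete? (allVecs n n))

-- The condition at j = 2 forces every entry of a complete α to be at least 2, so α = 1 + β for
-- a word β of length M + 1 over Fin M, where M = n − 1, and u_α(s + 2) ≥ 1 says that at most s
-- entries of β lie below s.  This is the setting of a cycle lemma: among the M rotations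
-- y ↦ y + c mod M of β exactly one has this property for all s < M, namely c = M − a where a is
-- the first maximiser of j ↦ #{entries < j} − j on [1, M].  Rotations permute Fin M, so every
-- rotation admits equally many such words, and M · #complete = M^(M+1).
module Submission where

open import Level using (Level)
open import Function using (_∘_; id; case_of_; _⇔_; mk⇔; Equivalence)
open import Relation.Nullary using (Dec; yes; no; ¬_; contradiction)
open import Relation.Unary using (Pred; Decidable)
open import Relation.Binary.PropositionalEquality
open import Data.Product using (_×_; _,_; ∃; proj₁)
open import Data.Sum using (_⊎_; inj₁; inj₂; [_,_]′)

open import Data.Nat using (ℕ; zero; suc; _+_; _*_; _∸_; _^_; _≤_; _<_; z≤n; s≤s; s≤s⁻¹; _≤?_; _<?_; _≟_; NonZero)
open import Data.Nat.Properties
open import Data.Nat.DivMod using (_%_; m%n<n; [m+n]%n≡m%n; m<n⇒m%n≡m)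
open import Data.Nat.ListAction using (sum)
open import Data.Nat.ListAction.Properties using (sum-++)
open import Data.Nat.Tactic.RingSolver using (solve-∀)
open import Data.Integer as ℤ using (_-_; _⊖_) renaming (+_ to pos)
import Data.Integer.Properties as ℤP
open import Algebra.Properties.CommutativeSemigroup +-commutativeSemigroup using (interchange)
import Algebra.Properties.CommutativeMonoid.Sum +-0-commutativeMonoid as FinSum

open import Data.List using (List; []; _∷_; _++_; map; length; filter; concatMap; upTo)
open import Data.List.Properties using (map-∘; map-cong; map-++; length-upTo)
open import Data.List.Membership.Propositional using (_∈_)
open import Data.List.Membership.Propositional.Properties using (∈-upTo⁺; ∈-upTo⁻; ∈-filter⁺; ∈-filter⁻; ∈-map⁺; ∈-map⁻)
open import Data.List.Relation.Unary.Any using (here; there)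
open import Data.List.Relation.Unary.All using (All; _∷_)
import Data.List.Relation.Unary.All as All
open import Data.List.Relation.Unary.Unique.Propositional using (Unique; _∷_)
open import Data.List.Relation.Unary.Unique.Propositional.Properties using (upTo⁺; map⁺; filter⁺)

open import Data.Fin as Fin using (Fin; toℕ)
open import Data.Fin.Properties using (toℕ<n; toℕ-fromℕ<; toℕ-injective)
open import Data.Fin.Permutation using (Permutation′; _⟨$⟩ʳ_; permutation)
open import Data.Vec as Vec using (Vec; []; _∷_; toList; tabulate; allFin)
open import Data.Vec.Properties using (length-toList; toList-map)
open import Data.Vec.Membership.Propositional using () renaming (_∈_ to _∈ᵥ_)
open import Data.Vec.Membership.Propositional.Properties using (∈-toList⁺)
import Data.Vec.Relation.Unary.Any as VecAny

open import Defs

private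
  variable
    a p q : Level
    A B : Set a

𝟙 : {P : Set p} → Dec P → ℕ
𝟙 (yes _) = 1
𝟙 (no _) = 0

𝟙-yes : {P : Set p} (P? : Dec P) → P → 𝟙 P? ≡ 1
𝟙-yes (yes _) _ = refl
𝟙-yes (no ¬P) P = contradiction P ¬P

𝟙-no : {P : Set p} (P? : Dec P) → ¬ P → 𝟙 P? ≡ 0
𝟙-no (yes P) ¬P = contradiction P ¬P
𝟙-no (no _) _ = refl

𝟙-cong : {P : Set p} {Q : Set q} (P? : Dec P) (Q? : Dec Q) → P ⇔ Q → 𝟙 P? ≡ 𝟙 Q?
𝟙-cong (yes P) (yes _) _ = refl
𝟙-cong (yes P) (no ¬Q) P⇔Q = contradiction (Equivalence.to P⇔Q P) ¬Q
𝟙-cong (no ¬P) (yes Q) P⇔Q = contradiction (Equivalence.from P⇔Q Q) ¬P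
𝟙-cong (no _) (no _) _ = refl

𝟙≤1 : {P : Set p} (P? : Dec P) → 𝟙 P? ≤ 1
𝟙≤1 (yes _) = ≤-refl
𝟙≤1 (no _) = z≤n

∑ : List A → (A → ℕ) → ℕ
∑ xs f = sum (map f xs)

syntax ∑ xs (λ x → e) = ∑[ x ∈ xs ] e

∑-cong : (xs : List A) {f g : A → ℕ} → f ≗ g → ∑ xs f ≡ ∑ xs g
∑-cong xs f≗g = cong sum (map-cong f≗g xs)

∑-cong-∈ : (xs : List A) {f g : A → ℕ} → (∀ {x} → x ∈ xs → f x ≡ g x) → ∑ xs f ≡ ∑ xs g
∑-cong-∈ [] _ = refl
∑-cong-∈ (x ∷ xs) f≡g = cong₂ _+_ (f≡g (here refl)) (∑-cong-∈ xs (f≡g ∘ there))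

∑-+ : (xs : List A) (f g : A → ℕ) → ∑[ x ∈ xs ] (f x + g x) ≡ ∑ xs f + ∑ xs g
∑-+ [] f g = refl
∑-+ (x ∷ xs) f g = trans (cong (f x + g x +_) (∑-+ xs f g)) (interchange (f x) (g x) _ _)

∑-const : (xs : List A) (c : ℕ) → ∑[ _ ∈ xs ] c ≡ length xs * c
∑-const [] c = refl
∑-const (x ∷ xs) c = cong (c +_) (∑-const xs c)

∑-0 : (xs : List A) → ∑[ _ ∈ xs ] 0 ≡ 0
∑-0 xs = trans (∑-const xs 0) (*-zeroʳ (length xs))

∑-1 : (xs : List A) → ∑[ _ ∈ xs ] 1 ≡ length xs
∑-1 xs = trans (∑-const xs 1) (*-identityʳ (length xs))

∑-map : (g : A → B) (xs : List A) (f : B → ℕ) → ∑ (map g xs) f ≡ ∑ xs (f ∘ g)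
∑-map g xs f = cong sum (sym (map-∘ xs))

∑-concatMap : (g : A → List B) (xs : List A) (f : B → ℕ) →
              ∑ (concatMap g xs) f ≡ ∑[ x ∈ xs ] ∑ (g x) f
∑-concatMap g [] f = refl
∑-concatMap g (x ∷ xs) f = begin
  sum (map f (g x ++ concatMap g xs))               ≡⟨ cong sum (map-++ f (g x) _) ⟩
  sum (map f (g x) ++ map f (concatMap g xs))      ≡⟨ sum-++ (map f (g x)) _ ⟩
  ∑ (g x) f + ∑ (concatMap g xs) f                  ≡⟨ cong (∑ (g x) f +_) (∑-concatMap g xs f) ⟩
  ∑ (g x) f + ∑[ x ∈ xs ] ∑ (g x) f                 ∎
  where open ≡-Reasoning

∑-comm : (xs : List A) (ys : List B) (f : A → B → ℕ) →
         ∑[ x ∈ xs ] ∑[ y ∈ ys ] f x y ≡ ∑[ y ∈ ys ] ∑[ x ∈ xs ] f x y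
∑-comm [] ys f = sym (∑-0 ys)
∑-comm (x ∷ xs) ys f =
  trans (cong (∑ ys (f x) +_) (∑-comm xs ys f)) (sym (∑-+ ys (f x) _))

module _ {P : Pred A p} (P? : Decidable P) where

  length-filter≡∑𝟙 : (xs : List A) → length (filter P? xs) ≡ ∑[ x ∈ xs ] 𝟙 (P? x)
  length-filter≡∑𝟙 [] = refl
  length-filter≡∑𝟙 (x ∷ xs) with P? x
  ... | yes _ = cong suc (length-filter≡∑𝟙 xs)
  ... | no _ = length-filter≡∑𝟙 xs

  ∑𝟙≤length : (xs : List A) → ∑[ x ∈ xs ] 𝟙 (P? x) ≤ length xs
  ∑𝟙≤length [] = z≤n
  ∑𝟙≤length (x ∷ xs) = +-mono-≤ (𝟙≤1 (P? x)) (∑𝟙≤length xs)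

  ∑𝟙<length : {x : A} {xs : List A} → x ∈ xs → ¬ P x → ∑[ y ∈ xs ] 𝟙 (P? y) < length xs
  ∑𝟙<length {x} {xs = _ ∷ ys} (here refl) ¬Px rewrite 𝟙-no (P? x) ¬Px = s≤s (∑𝟙≤length ys)
  ∑𝟙<length {xs = y ∷ ys} (there x∈) ¬Px =
    subst (_≤ length (y ∷ ys)) (+-suc _ _) (+-mono-≤ (𝟙≤1 (P? y)) (∑𝟙<length x∈ ¬Px))

  ∑𝟙≡0 : (xs : List A) → All (¬_ ∘ P) xs → ∑[ x ∈ xs ] 𝟙 (P? x) ≡ 0
  ∑𝟙≡0 [] _ = refl
  ∑𝟙≡0 (x ∷ xs) (¬Px ∷ ¬Pxs) = cong₂ _+_ (𝟙-no (P? x) ¬Px) (∑𝟙≡0 xs ¬Pxs)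

  ∑𝟙≡1 : {x : A} {xs : List A} → Unique xs → x ∈ xs → P x →
         (∀ {y} → y ∈ xs → P y → y ≡ x) → ∑[ y ∈ xs ] 𝟙 (P? y) ≡ 1
  ∑𝟙≡1 {xs = y ∷ ys} (y∉ys ∷ _) (here refl) Py only =
    cong₂ _+_ (𝟙-yes (P? y) Py) (∑𝟙≡0 ys (All.tabulate λ z∈ Pz → All.lookup y∉ys z∈ (sym (only (there z∈) Pz))))
  ∑𝟙≡1 {x} {y ∷ ys} (y∉ys ∷ unique) (there x∈) Px only =
    cong₂ _+_ (𝟙-no (P? y) λ Py → All.lookup y∉ys x∈ (only (here refl) Py)) (∑𝟙≡1 unique x∈ Px (only ∘ there))

∑-tabulate : ∀ {k} (f : Fin k → A) (g : A → ℕ) → ∑ (toList (tabulate f)) g ≡ FinSum.sum (g ∘ f)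
∑-tabulate {k = zero} f g = refl
∑-tabulate {k = suc k} f g = cong (g (f Fin.zero) +_) (∑-tabulate (f ∘ Fin.suc) g)

∑-allVecs-suc : ∀ n k (F : Vec (Fin n) (suc k) → ℕ) →
                ∑ (allVecs n (suc k)) F ≡ ∑[ x ∈ toList (allFin n) ] ∑[ w ∈ allVecs n k ] F (x ∷ w)
∑-allVecs-suc n k F =
  trans (∑-concatMap _ (toList (allFin n)) F) (∑-cong (toList (allFin n)) λ x → ∑-map (x ∷_) (allVecs n k) F)

length-allVecs : ∀ n k → length (allVecs n k) ≡ n ^ k
length-allVecs n zero = refl
length-allVecs n (suc k) = begin
  length (allVecs n (suc k))                            ≡⟨ ∑-1 (allVecs n (suc k)) ⟨
  ∑[ _ ∈ allVecs n (suc k) ] 1                          ≡⟨ ∑-allVecs-suc n k _ ⟩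
  ∑[ x ∈ toList (allFin n) ] ∑[ _ ∈ allVecs n k ] 1     ≡⟨ ∑-cong (toList (allFin n)) (λ _ → ∑-1 (allVecs n k)) ⟩
  ∑[ x ∈ toList (allFin n) ] length (allVecs n k)       ≡⟨ ∑-const (toList (allFin n)) _ ⟩
  length (toList (allFin n)) * length (allVecs n k)     ≡⟨ cong₂ _*_ (length-toList (allFin n)) (length-allVecs n k) ⟩
  n * n ^ k                                             ∎
  where open ≡-Reasoning

∑-allVecs-permute : ∀ n k (π : Permutation′ n) (F : Vec (Fin n) k → ℕ) →
                    ∑[ w ∈ allVecs n k ] F (Vec.map (π ⟨$⟩ʳ_) w) ≡ ∑ (allVecs n k) F
∑-allVecs-permute n zero π F = refl
∑-allVecs-permute n (suc k) π F = begin
  ∑[ w ∈ allVecs n (suc k) ] F (Vec.map (π ⟨$⟩ʳ_) w)                  ≡⟨ ∑-allVecs-suc n k _ ⟩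
  ∑[ x ∈ toList (allFin n) ] ∑[ w ∈ allVecs n k ] F ((π ⟨$⟩ʳ x) ∷ Vec.map (π ⟨$⟩ʳ_) w)
    ≡⟨ ∑-cong (toList (allFin n)) (λ x → ∑-allVecs-permute n k π (F ∘ ((π ⟨$⟩ʳ x) ∷_))) ⟩
  ∑[ x ∈ toList (allFin n) ] G (π ⟨$⟩ʳ x)                              ≡⟨ ∑-tabulate id (G ∘ (π ⟨$⟩ʳ_)) ⟩
  FinSum.sum (G ∘ (π ⟨$⟩ʳ_))                                          ≡⟨ sym (FinSum.sum-permute G π) ⟩
  FinSum.sum G                                                       ≡⟨ sym (∑-tabulate id G) ⟩
  ∑[ x ∈ toList (allFin n) ] G x                                      ≡⟨ sym (∑-allVecs-suc n k F) ⟩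
  ∑ (allVecs n (suc k)) F                                            ∎
  where
  open ≡-Reasoning
  G : Fin n → ℕ
  G x = ∑[ w ∈ allVecs n k ] F (x ∷ w)

∑-allVecs-avoiding-zero : ∀ m k (F : Vec (Fin (suc m)) k → ℕ) → (∀ w → Fin.zero ∈ᵥ w → F w ≡ 0) →
                          ∑ (allVecs (suc m) k) F ≡ ∑[ w ∈ allVecs m k ] F (Vec.map Fin.suc w)
∑-allVecs-avoiding-zero m zero F _ = refl
∑-allVecs-avoiding-zero m (suc k) F F≡0 = begin
  ∑ (allVecs (suc m) (suc k)) F                                        ≡⟨ ∑-allVecs-suc (suc m) k F ⟩
  ∑[ w ∈ allVecs (suc m) k ] F (Fin.zero ∷ w) + ∑[ x ∈ toList (tabulate Fin.suc) ] G x
    ≡⟨ cong₂ _+_ (∑𝟘 (allVecs (suc m) k)) (trans (∑-tabulate Fin.suc G) (sym (∑-tabulate id (G ∘ Fin.suc)))) ⟩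
  ∑[ x ∈ toList (allFin m) ] ∑[ w ∈ allVecs (suc m) k ] F (Fin.suc x ∷ w)
    ≡⟨ ∑-cong (toList (allFin m)) (λ x → ∑-allVecs-avoiding-zero m k (F ∘ (Fin.suc x ∷_))
                                           (λ w z∈w → F≡0 _ (VecAny.there z∈w))) ⟩
  ∑[ x ∈ toList (allFin m) ] ∑[ w ∈ allVecs m k ] F (Fin.suc x ∷ Vec.map Fin.suc w) ≡⟨ sym (∑-allVecs-suc m k _) ⟩
  ∑[ w ∈ allVecs m (suc k) ] F (Vec.map Fin.suc w)                     ∎
  where
  open ≡-Reasoning
  G : Fin (suc m) → ℕ
  G x = ∑[ w ∈ allVecs (suc m) k ] F (x ∷ w)
  ∑𝟘 : ∀ ws → ∑[ w ∈ ws ] F (Fin.zero ∷ w) ≡ 0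
  ∑𝟘 ws = trans (∑-cong ws (λ w → F≡0 _ (VecAny.here refl))) (∑-0 ws)

record IsFirstArgMax (E : ℕ → ℕ) (m a : ℕ) : Set where
  field
    1≤a : 1 ≤ a
    a≤m : a ≤ m
    before : ∀ {j} → 1 ≤ j → j < a → E j < E a
    after : ∀ {j} → a ≤ j → j ≤ m → E j ≤ E a

firstArgMax : ∀ E m → ∃ (IsFirstArgMax E (suc m))
firstArgMax E zero = 1 , record
  { 1≤a = ≤-refl
  ; a≤m = ≤-refl
  ; before = λ 1≤j j<1 → contradiction (<-≤-trans j<1 1≤j) (<-irrefl refl)
  ; after = λ 1≤j j≤1 → ≤-reflexive (cong E (≤-antisym j≤1 1≤j))
  }
firstArgMax E (suc m) with firstArgMax E m
... | a , isMax with E (suc (suc m)) ≤? E a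
...   | yes last≤ = a , record
  { 1≤a = 1≤a
  ; a≤m = m≤n⇒m≤1+n a≤m
  ; before = before
  ; after = λ a≤j j≤m+2 →
      [ (λ j<m+2 → after a≤j (s≤s⁻¹ j<m+2)) , (λ { refl → last≤ }) ]′ (m≤n⇒m<n∨m≡n j≤m+2)
  }
  where open IsFirstArgMax isMax
...   | no last≰ = suc (suc m) , record
  { 1≤a = s≤s z≤n
  ; a≤m = ≤-refl
  ; before = λ {j} 1≤j j<m+2 → case j <? a of λ
      { (yes j<a) → <-trans (before 1≤j j<a) Ea<last
      ; (no j≮a) → ≤-<-trans (after (≮⇒≥ j≮a) (s≤s⁻¹ j<m+2)) Ea<last }
  ; after = λ m+2≤j j≤m+2 → ≤-reflexive (cong E (≤-antisym j≤m+2 m+2≤j))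
  }
  where
  open IsFirstArgMax isMax
  Ea<last : E a < E (suc (suc m))
  Ea<last = ≰⇒> last≰

firstArgMax-≮ : ∀ {E m a a′} → IsFirstArgMax E m a → IsFirstArgMax E m a′ → ¬ a < a′
firstArgMax-≮ isMax isMax′ a<a′ =
  <-irrefl refl (<-≤-trans (before isMax′ (1≤a isMax) a<a′) (after isMax (<⇒≤ a<a′) (a≤m isMax′)))
  where open IsFirstArgMax

firstArgMax-unique : ∀ {E m a a′} → IsFirstArgMax E m a → IsFirstArgMax E m a′ → a ≡ a′
firstArgMax-unique isMax isMax′ =
  ≤-antisym (≮⇒≥ (firstArgMax-≮ isMax′ isMax)) (≮⇒≥ (firstArgMax-≮ isMax isMax′))

+∸-≤⇔ : ∀ x y {m j a} → j ≤ m → a ≤ m → (x + (m ∸ j) ≤ y + (m ∸ a)) ⇔ (x + a ≤ y + j)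
+∸-≤⇔ x y {m} {j} {a} j≤m a≤m = mk⇔
  (λ le → +-cancelʳ-≤ m _ _ (subst₂ _≤_ shiftˡ shiftʳ (+-monoˡ-≤ (j + a) le)))
  (λ le → +-cancelʳ-≤ (j + a) _ _ (subst₂ _≤_ (sym shiftˡ) (sym shiftʳ) (+-monoˡ-≤ m le)))
  where
  shiftˡ : x + (m ∸ j) + (j + a) ≡ x + a + m
  shiftˡ = trans (regroup x (m ∸ j) j a) (cong (x + a +_) (m∸n+n≡m j≤m))
    where
    regroup : ∀ x d j a → x + d + (j + a) ≡ x + a + (d + j)
    regroup = solve-∀
  shiftʳ : y + (m ∸ a) + (j + a) ≡ y + j + m
  shiftʳ = trans (regroup y (m ∸ a) j a) (cong (y + j +_) (m∸n+n≡m a≤m))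
    where
    regroup : ∀ y d j a → y + d + (j + a) ≡ y + j + (d + a)
    regroup = solve-∀

+≡+⇒≤⇔≤ : ∀ {g p s q} → g + p ≡ s + q → q ≤ g ⇔ p ≤ s
+≡+⇒≤⇔≤ {g} {p} {s} {q} g+p≡s+q = mk⇔
  (λ q≤g → +-cancelʳ-≤ q p s (subst₂ _≤_ (+-comm q p) g+p≡s+q (+-monoˡ-≤ p q≤g)))
  (λ p≤s → +-cancelʳ-≤ p q g (subst (q + p ≤_) (trans (+-comm q s) (sym g+p≡s+q)) (+-monoʳ-≤ q p≤s)))

∸<⇔<+ : ∀ {a y s} → a ≤ y → (y ∸ a < s) ⇔ (y < a + s)
∸<⇔<+ {a} {y} {s} a≤y = mk⇔
  (λ y∸a<s → subst (_< a + s) (m+[n∸m]≡n a≤y) (+-monoʳ-< a y∸a<s))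
  (λ y<a+s → +-cancelˡ-< a (y ∸ a) s (subst (_< a + s) (sym (m+[n∸m]≡n a≤y)) y<a+s))

∑-toList-map : ∀ {L} (g : A → B) (xs : Vec A L) (f : B → ℕ) → ∑ (toList (Vec.map g xs)) f ≡ ∑ (toList xs) (f ∘ g)
∑-toList-map g xs f = trans (cong (λ ys → ∑ ys f) (toList-map g xs)) (∑-map g (toList xs) f)

below : ∀ {n L} → Vec (Fin n) L → ℕ → ℕ
below β s = ∑[ y ∈ toList β ] 𝟙 (toℕ y <? s)

FewBelow : ∀ {M L} → Vec (Fin M) L → Set
FewBelow {M} β = ∀ {s} → s < M → below β s ≤ s

fewBelow? : ∀ {M L} (β : Vec (Fin M) L) → Dec (FewBelow β)
fewBelow? {M} β = allUpTo? (λ s → below β s ≤? s) M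

module Rotation (M : ℕ) .{{_ : NonZero M}} where

  rotate : ℕ → Fin M → Fin M
  rotate c y = Fin.fromℕ< (m%n<n (toℕ y + c) M)

  toℕ-rotate : ∀ c y → toℕ (rotate c y) ≡ (toℕ y + c) % M
  toℕ-rotate c y = toℕ-fromℕ< (m%n<n (toℕ y + c) M)

  %-wrap : ∀ {a c y} → a + c ≡ M → y < M →
           (y < a × (y + c) % M ≡ y + c) ⊎ (a ≤ y × (y + c) % M ≡ y ∸ a)
  %-wrap {a} {c} {y} a+c≡M y<M with y <? a
  ... | yes y<a = inj₁ (y<a , m<n⇒m%n≡m (subst (y + c <_) a+c≡M (+-monoˡ-< c y<a)))
  ... | no y≮a = inj₂ (a≤y , (begin
    (y + c) % M           ≡⟨ cong (λ t → (t + c) % M) (sym (m∸n+n≡m a≤y)) ⟩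
    (y ∸ a + a + c) % M   ≡⟨ cong (_% M) (trans (+-assoc (y ∸ a) a c) (cong (y ∸ a +_) a+c≡M)) ⟩
    (y ∸ a + M) % M       ≡⟨ [m+n]%n≡m%n (y ∸ a) M ⟩
    (y ∸ a) % M           ≡⟨ m<n⇒m%n≡m (≤-<-trans (m∸n≤m y a) y<M) ⟩
    y ∸ a                 ∎))
    where
    open ≡-Reasoning
    a≤y : a ≤ y
    a≤y = ≮⇒≥ y≮a

  %-wrap-inverse : ∀ {c c′ y} → c′ + c ≡ M → y < M → ((y + c) % M + c′) % M ≡ y
  %-wrap-inverse {c} {c′} {y} c′+c≡M y<M with %-wrap c′+c≡M y<M
  ... | inj₁ (_ , wrap) = begin
    ((y + c) % M + c′) % M ≡⟨ cong (λ t → (t + c′) % M) wrap ⟩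
    (y + c + c′) % M       ≡⟨ cong (_% M) (trans (+-assoc y c c′) (cong (y +_) (trans (+-comm c c′) c′+c≡M))) ⟩
    (y + M) % M            ≡⟨ [m+n]%n≡m%n y M ⟩
    y % M                  ≡⟨ m<n⇒m%n≡m y<M ⟩
    y                      ∎
    where open ≡-Reasoning
  ... | inj₂ (c′≤y , wrap) = begin
    ((y + c) % M + c′) % M ≡⟨ cong (λ t → (t + c′) % M) wrap ⟩
    (y ∸ c′ + c′) % M      ≡⟨ cong (_% M) (m∸n+n≡m c′≤y) ⟩
    y % M                  ≡⟨ m<n⇒m%n≡m y<M ⟩
    y                      ∎
    where open ≡-Reasoning

  rotate-inverse : ∀ {c c′} → c′ + c ≡ M → rotate c′ ∘ rotate c ≗ id
  rotate-inverse {c} {c′} c′+c≡M y = toℕ-injective (begin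
    toℕ (rotate c′ (rotate c y))        ≡⟨ toℕ-rotate c′ (rotate c y) ⟩
    (toℕ (rotate c y) + c′) % M         ≡⟨ cong (λ t → (t + c′) % M) (toℕ-rotate c y) ⟩
    ((toℕ y + c) % M + c′) % M          ≡⟨ %-wrap-inverse c′+c≡M (toℕ<n y) ⟩
    toℕ y                               ∎)
    where open ≡-Reasoning

  rotation : ∀ {c} → c ≤ M → Permutation′ M
  rotation {c} c≤M = permutation (rotate c) (rotate (M ∸ c))
    (rotate-inverse (m+[n∸m]≡n c≤M)) (rotate-inverse (m∸n+n≡m c≤M))

  -- Rotation by c maps [a, M) onto [0, c) and [0, a) onto [c, M).
  module _ {a c : ℕ} (a+c≡M : a + c ≡ M) where

    𝟙-wrap-≤ : ∀ {s} → s ≤ c → ∀ {y} → y < M →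
               𝟙 ((y + c) % M <? s) + 𝟙 (y <? a) ≡ 𝟙 (y <? a + s)
    𝟙-wrap-≤ {s} s≤c {y} y<M with %-wrap a+c≡M y<M
    ... | inj₁ (y<a , wrap) = begin
      𝟙 ((y + c) % M <? s) + 𝟙 (y <? a) ≡⟨ cong (λ t → 𝟙 (t <? s) + 𝟙 (y <? a)) wrap ⟩
      𝟙 (y + c <? s) + 𝟙 (y <? a)       ≡⟨ cong₂ _+_ (𝟙-no (y + c <? s) (≤⇒≯ (≤-trans s≤c (m≤n+m c y))))
                                                     (𝟙-yes (y <? a) y<a) ⟩
      1                                 ≡⟨ 𝟙-yes (y <? a + s) (<-≤-trans y<a (m≤m+n a s)) ⟨
      𝟙 (y <? a + s)                    ∎
      where open ≡-Reasoning
    ... | inj₂ (a≤y , wrap) = begin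
      𝟙 ((y + c) % M <? s) + 𝟙 (y <? a) ≡⟨ cong₂ (λ t u → 𝟙 (t <? s) + u) wrap (𝟙-no (y <? a) (≤⇒≯ a≤y)) ⟩
      𝟙 (y ∸ a <? s) + 0                ≡⟨ +-identityʳ _ ⟩
      𝟙 (y ∸ a <? s)                    ≡⟨ 𝟙-cong (y ∸ a <? s) (y <? a + s) (∸<⇔<+ a≤y) ⟩
      𝟙 (y <? a + s)                    ∎
      where open ≡-Reasoning

    𝟙-wrap-> : ∀ {r} → c + r < M → ∀ {y} → y < M →
               𝟙 ((y + c) % M <? c + r) + 𝟙 (y <? a) ≡ 𝟙 (y <? r) + 1
    𝟙-wrap-> {r} c+r<M {y} y<M with %-wrap a+c≡M y<M
    ... | inj₁ (y<a , wrap) = begin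
      𝟙 ((y + c) % M <? c + r) + 𝟙 (y <? a) ≡⟨ cong₂ (λ t u → 𝟙 (t <? c + r) + u) wrap (𝟙-yes (y <? a) y<a) ⟩
      𝟙 (y + c <? c + r) + 1                ≡⟨ cong (_+ 1) (𝟙-cong (y + c <? c + r) (y <? r) shift) ⟩
      𝟙 (y <? r) + 1                        ∎
      where
      open ≡-Reasoning
      shift : (y + c < c + r) ⇔ (y < r)
      shift = mk⇔ (λ y+c<c+r → +-cancelʳ-< c y r (subst (y + c <_) (+-comm c r) y+c<c+r))
                  (λ y<r → subst (y + c <_) (+-comm r c) (+-monoˡ-< c y<r))
    ... | inj₂ (a≤y , wrap) = begin
      𝟙 ((y + c) % M <? c + r) + 𝟙 (y <? a) ≡⟨ cong₂ (λ t u → 𝟙 (t <? c + r) + u) wrap (𝟙-no (y <? a) (≤⇒≯ a≤y)) ⟩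
      𝟙 (y ∸ a <? c + r) + 0                ≡⟨ cong (_+ 0) (𝟙-yes (y ∸ a <? c + r) y∸a<c+r) ⟩
      1                                     ≡⟨ cong (_+ 1) (𝟙-no (y <? r) (≤⇒≯ (≤-trans (<⇒≤ r<a) a≤y))) ⟨
      𝟙 (y <? r) + 1                        ∎
      where
      open ≡-Reasoning
      r<a : r < a
      r<a = +-cancelˡ-< c r a (subst (c + r <_) (trans (sym a+c≡M) (+-comm a c)) c+r<M)
      y∸a<c+r : y ∸ a < c + r
      y∸a<c+r = ≤-trans (+-cancelˡ-< a (y ∸ a) c (subst₂ _<_ (sym (m+[n∸m]≡n a≤y)) (sym a+c≡M) y<M)) (m≤m+n c r)

    below-rotate : ∀ {L} (β : Vec (Fin M) L) s →
                   below (Vec.map (rotate c) β) s + below β a ≡ ∑[ y ∈ toList β ] (𝟙 ((toℕ y + c) % M <? s) + 𝟙 (toℕ y <? a))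
    below-rotate β s = begin
      below (Vec.map (rotate c) β) s + below β a                 ≡⟨ cong (_+ below β a) (∑-toList-map (rotate c) β _) ⟩
      ∑[ y ∈ toList β ] 𝟙 (toℕ (rotate c y) <? s) + below β a   ≡⟨ ∑-+ (toList β) _ _ ⟨
      ∑[ y ∈ toList β ] (𝟙 (toℕ (rotate c y) <? s) + 𝟙 (toℕ y <? a))
        ≡⟨ ∑-cong (toList β) (λ y → cong (λ t → 𝟙 (t <? s) + 𝟙 (toℕ y <? a)) (toℕ-rotate c y)) ⟩
      ∑[ y ∈ toList β ] (𝟙 ((toℕ y + c) % M <? s) + 𝟙 (toℕ y <? a)) ∎
      where open ≡-Reasoning

    below-rotate-≤ : ∀ {L} (β : Vec (Fin M) L) {s} → s ≤ c →
                     below (Vec.map (rotate c) β) s + below β a ≡ below β (a + s)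
    below-rotate-≤ β s≤c =
      trans (below-rotate β _) (∑-cong (toList β) (λ y → 𝟙-wrap-≤ s≤c (toℕ<n y)))

    below-rotate-> : ∀ {L} (β : Vec (Fin M) L) {r} → c + r < M →
                     below (Vec.map (rotate c) β) (c + r) + below β a ≡ below β r + L
    below-rotate-> {L} β {r} c+r<M = begin
      below (Vec.map (rotate c) β) (c + r) + below β a ≡⟨ below-rotate β (c + r) ⟩
      ∑[ y ∈ toList β ] (𝟙 ((toℕ y + c) % M <? c + r) + 𝟙 (toℕ y <? a))
        ≡⟨ ∑-cong (toList β) (λ y → 𝟙-wrap-> c+r<M (toℕ<n y)) ⟩
      ∑[ y ∈ toList β ] (𝟙 (toℕ y <? r) + 1)          ≡⟨ ∑-+ (toList β) _ _ ⟩
      below β r + ∑[ _ ∈ toList β ] 1                  ≡⟨ cong (below β r +_) (trans (∑-1 (toList β)) (length-toList β)) ⟩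
      below β r + L                                    ∎
      where open ≡-Reasoning

module CycleLemma (k : ℕ) (β : Vec (Fin (suc k)) (suc (suc k))) where

  open Rotation (suc k)

  M : ℕ
  M = suc k

  rotated : ℕ → Vec (Fin M) (suc M)
  rotated c = Vec.map (rotate c) β

  -- below β j − j, shifted by M to stay in ℕ
  height : ℕ → ℕ
  height j = below β j + (M ∸ j)

  module _ {a c : ℕ} (a+c≡M : a + c ≡ M) where

    private
      a≤M : a ≤ M
      a≤M = subst (a ≤_) a+c≡M (m≤m+n a c)

      height<⇔ : ∀ {j} → j ≤ M → height j < height a ⇔ suc (below β j) + a ≤ below β a + j
      height<⇔ j≤M = +∸-≤⇔ (suc (below β _)) (below β a) j≤M a≤M

      height≤⇔ : ∀ {j} → j ≤ M → height j ≤ height a ⇔ below β j + a ≤ below β a + j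
      height≤⇔ j≤M = +∸-≤⇔ (below β _) (below β a) j≤M a≤M

      regroupˡ : ∀ x a c → x + suc (a + c) ≡ suc x + a + c
      regroupˡ = solve-∀

      regroupʳ : ∀ x r c → x + r + c ≡ c + r + x
      regroupʳ = solve-∀

    fewBelow⇒firstArgMax : 1 ≤ a → FewBelow (rotated c) → IsFirstArgMax height M a
    fewBelow⇒firstArgMax 1≤a few = record { 1≤a = 1≤a ; a≤m = a≤M ; before = before ; after = after }
      where
      before : ∀ {j} → 1 ≤ j → j < a → height j < height a
      before {j} _ j<a = Equivalence.from (height<⇔ (<⇒≤ (<-≤-trans j<a a≤M))) (+-cancelʳ-≤ c _ _ (begin
        suc (below β j) + a + c               ≡⟨ regroupˡ (below β j) a c ⟨
        below β j + suc (a + c)               ≡⟨ cong (λ t → below β j + suc t) a+c≡M ⟩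
        below β j + suc M                     ≡⟨ below-rotate-> a+c≡M β c+j<M ⟨
        below (rotated c) (c + j) + below β a ≤⟨ +-monoˡ-≤ (below β a) (few c+j<M) ⟩
        c + j + below β a                     ≡⟨ regroupʳ (below β a) j c ⟨
        below β a + j + c                     ∎))
        where
        open ≤-Reasoning
        c+j<M : c + j < M
        c+j<M = subst (c + j <_) (trans (+-comm c a) a+c≡M) (+-monoʳ-< c j<a)

      after : ∀ {j} → a ≤ j → j ≤ M → height j ≤ height a
      after {j} a≤j j≤M with s , refl ← m≤n⇒∃[o]m+o≡n a≤j = Equivalence.from (height≤⇔ j≤M) (begin
        below β (a + s) + a                  ≡⟨ cong (_+ a) (below-rotate-≤ a+c≡M β s≤c) ⟨
        below (rotated c) s + below β a + a  ≤⟨ +-monoˡ-≤ a (+-monoˡ-≤ (below β a) (few (≤-<-trans s≤c c<M))) ⟩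
        s + below β a + a                    ≡⟨ regroup s (below β a) a ⟩
        below β a + (a + s)                  ∎)
        where
        open ≤-Reasoning
        s≤c : s ≤ c
        s≤c = +-cancelˡ-≤ a s c (subst (a + s ≤_) (sym a+c≡M) j≤M)
        c<M : c < M
        c<M = subst (c <_) a+c≡M (m<n+m c 1≤a)
        regroup : ∀ s x a → s + x + a ≡ x + (a + s)
        regroup = solve-∀

    firstArgMax⇒fewBelow : IsFirstArgMax height M a → FewBelow (rotated c)
    firstArgMax⇒fewBelow isMax {s} s<M with s ≤? c
    ... | yes s≤c = +-cancelʳ-≤ (below β a + a) _ _ (begin
      below (rotated c) s + (below β a + a) ≡⟨ +-assoc (below (rotated c) s) (below β a) a ⟨
      below (rotated c) s + below β a + a   ≡⟨ cong (_+ a) (below-rotate-≤ a+c≡M β s≤c) ⟩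
      below β (a + s) + a                   ≤⟨ Equivalence.to (height≤⇔ a+s≤M) (after (m≤m+n a s) a+s≤M) ⟩
      below β a + (a + s)                   ≡⟨ regroup (below β a) a s ⟩
      s + (below β a + a)                   ∎)
      where
      open IsFirstArgMax isMax
      open ≤-Reasoning
      a+s≤M : a + s ≤ M
      a+s≤M = subst (a + s ≤_) a+c≡M (+-monoʳ-≤ a s≤c)
      regroup : ∀ x a s → x + (a + s) ≡ s + (x + a)
      regroup = solve-∀
    ... | no s≰c with r , refl ← m≤n⇒∃[o]m+o≡n (<⇒≤ (≰⇒> s≰c)) = +-cancelʳ-≤ (below β a) _ _ (begin
      below (rotated c) (c + r) + below β a ≡⟨ below-rotate-> a+c≡M β s<M ⟩
      below β r + suc M                     ≡⟨ cong (λ t → below β r + suc t) a+c≡M ⟨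
      below β r + suc (a + c)               ≡⟨ regroupˡ (below β r) a c ⟩
      suc (below β r) + a + c               ≤⟨ +-monoˡ-≤ c (Equivalence.to (height<⇔ (<⇒≤ (<-≤-trans r<a a≤m))) (before 1≤r r<a)) ⟩
      below β a + r + c                     ≡⟨ regroupʳ (below β a) r c ⟩
      c + r + below β a                     ∎)
      where
      open IsFirstArgMax isMax
      open ≤-Reasoning
      1≤r : 1 ≤ r
      1≤r = +-cancelˡ-≤ c 1 r (subst (_≤ c + r) (+-comm 1 c) (≰⇒> s≰c))
      r<a : r < a
      r<a = +-cancelˡ-< c r a (subst (c + r <_) (trans (sym a+c≡M) (+-comm a c)) s<M)

  cycle-lemma : ∑[ c ∈ upTo M ] 𝟙 (fewBelow? (rotated c)) ≡ 1
  cycle-lemma with a , isMax ← firstArgMax height k =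
    ∑𝟙≡1 (fewBelow? ∘ rotated) (upTo⁺ M) (∈-upTo⁺ (∸-monoʳ-< 1≤a a≤m))
         (firstArgMax⇒fewBelow (m+[n∸m]≡n a≤m) isMax) only
    where
    open IsFirstArgMax isMax
    only : ∀ {c} → c ∈ upTo M → FewBelow (rotated c) → c ≡ M ∸ a
    only {c} c∈ few = begin
      c           ≡⟨ m∸[m∸n]≡n (<⇒≤ c<M) ⟨
      M ∸ (M ∸ c) ≡⟨ cong (M ∸_) (firstArgMax-unique isMax′ isMax) ⟩
      M ∸ a       ∎
      where
      open ≡-Reasoning
      c<M : c < M
      c<M = ∈-upTo⁻ c∈
      isMax′ : IsFirstArgMax height M (M ∸ c)
      isMax′ = fewBelow⇒firstArgMax (m∸n+n≡m (<⇒≤ c<M)) (m<n⇒0<n∸m c<M) few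

count-fewBelow : ∀ k → ∑ (allVecs (suc k) (suc (suc k))) (𝟙 ∘ fewBelow?) ≡ suc k ^ suc k
count-fewBelow k = *-cancelˡ-≡ T (M ^ M) M (begin
  M * T                                                              ≡⟨ cong (_* T) (length-upTo M) ⟨
  length (upTo M) * T                                                ≡⟨ ∑-const (upTo M) T ⟨
  ∑[ c ∈ upTo M ] T                                                  ≡⟨ ∑-cong-∈ (upTo M) rotation-invariant ⟩
  ∑[ c ∈ upTo M ] ∑[ β ∈ Vecs ] 𝟙 (fewBelow? (Vec.map (rotate c) β)) ≡⟨ ∑-comm (upTo M) Vecs _ ⟩
  ∑[ β ∈ Vecs ] ∑[ c ∈ upTo M ] 𝟙 (fewBelow? (Vec.map (rotate c) β)) ≡⟨ ∑-cong Vecs (λ β → CycleLemma.cycle-lemma k β) ⟩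
  ∑[ β ∈ Vecs ] 1                                                    ≡⟨ ∑-1 Vecs ⟩
  length Vecs                                                        ≡⟨ length-allVecs M (suc M) ⟩
  M * M ^ M                                                          ∎)
  where
  open ≡-Reasoning
  open Rotation (suc k)
  M : ℕ
  M = suc k
  Vecs : List (Vec (Fin M) (suc M))
  Vecs = allVecs M (suc M)
  T : ℕ
  T = ∑ Vecs (𝟙 ∘ fewBelow?)
  rotation-invariant : ∀ {c} → c ∈ upTo M → T ≡ ∑[ β ∈ Vecs ] 𝟙 (fewBelow? (Vec.map (rotate c) β))
  rotation-invariant c∈ = sym (∑-allVecs-permute M (suc M) (rotation (<⇒≤ (∈-upTo⁻ c∈))) (𝟙 ∘ fewBelow?))

fromTo : ℕ → ℕ → List ℕ
fromTo j n = filter (j ≤?_) (map suc (upTo n))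

∈-fromTo⁺ : ∀ {i j n} → j ≤ suc i → i < n → suc i ∈ fromTo j n
∈-fromTo⁺ j≤1+i i<n = ∈-filter⁺ (_ ≤?_) (∈-map⁺ suc (∈-upTo⁺ i<n)) j≤1+i

∈-fromTo⁻ : ∀ {i j n} → i ∈ fromTo j n → j ≤ i × i ≤ n
∈-fromTo⁻ {n = n} i∈ with ∈-filter⁻ (_ ≤?_) {xs = map suc (upTo n)} i∈
... | i∈suc[upTo] , j≤i with ∈-map⁻ suc i∈suc[upTo]
...   | _ , x∈upTo , refl = j≤i , ∈-upTo⁻ x∈upTo

fromTo-unique : ∀ j n → Unique (fromTo j n)
fromTo-unique j n = filter⁺ (j ≤?_) (map⁺ suc-injective (upTo⁺ n))

∑-fromTo-𝟙≟ : ∀ {j n t} → t < n → ∑[ i ∈ fromTo j n ] 𝟙 (suc t ≟ i) ≡ 𝟙 (j ≤? suc t)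
∑-fromTo-𝟙≟ {j} {n} {t} t<n with j ≤? suc t
... | yes j≤1+t = ∑𝟙≡1 (suc t ≟_) (fromTo-unique j n) (∈-fromTo⁺ j≤1+t t<n) refl (λ _ → sym)
... | no j≰1+t = ∑𝟙≡0 (suc t ≟_) (fromTo j n) (All.tabulate λ { i∈ refl → j≰1+t (proj₁ (∈-fromTo⁻ {n = n} i∈)) })

numAtLeast : ∀ {n L} → Vec (Fin n) L → ℕ → ℕ
numAtLeast α j = ∑[ x ∈ toList α ] 𝟙 (j ≤? suc (toℕ x))

count-as-∑ : ∀ {n L} (α : Vec (Fin n) L) i → count α i ≡ ∑[ x ∈ toList α ] 𝟙 (suc (toℕ x) ≟ i)
count-as-∑ [] i = refl
count-as-∑ (x ∷ α) i with suc (toℕ x) ≟ i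
... | yes _ = cong suc (count-as-∑ α i)
... | no _ = count-as-∑ α i

sumFrom-count : ∀ {n L} (α : Vec (Fin n) L) j → sumFrom j n (count α) ≡ numAtLeast α j
sumFrom-count {n} α j = begin
  ∑[ i ∈ fromTo j n ] count α i                                   ≡⟨ ∑-cong (fromTo j n) (count-as-∑ α) ⟩
  ∑[ i ∈ fromTo j n ] ∑[ x ∈ toList α ] 𝟙 (suc (toℕ x) ≟ i)       ≡⟨ ∑-comm (fromTo j n) (toList α) _ ⟩
  ∑[ x ∈ toList α ] ∑[ i ∈ fromTo j n ] 𝟙 (suc (toℕ x) ≟ i)       ≡⟨ ∑-cong (toList α) (λ x → ∑-fromTo-𝟙≟ (toℕ<n x)) ⟩
  numAtLeast α j                                                  ∎
  where open ≡-Reasoning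

u-as-⊖ : ∀ {n} (α : Pref n) {j} → j ≤ n → u α j ≡ numAtLeast α j ⊖ (n ∸ j + 1)
u-as-⊖ {n} α {j} j≤n = begin
  pos (sumFrom j n (count α)) - ((pos n - pos j) ℤ.+ pos 1)
    ≡⟨ cong₂ (λ g d → pos g - (d ℤ.+ pos 1)) (sumFrom-count α j) n-j≡n∸j ⟩
  pos (numAtLeast α j) - pos (n ∸ j + 1)
    ≡⟨ ℤP.[+m]-[+n]≡m⊖n (numAtLeast α j) (n ∸ j + 1) ⟩
  numAtLeast α j ⊖ (n ∸ j + 1)
    ∎
  where
  open ≡-Reasoning
  n-j≡n∸j : pos n - pos j ≡ pos (n ∸ j)
  n-j≡n∸j = trans (ℤP.[+m]-[+n]≡m⊖n n j) (ℤP.⊖-≥ j≤n)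

1≤⊖⇔< : ∀ {m n} → pos 1 ℤ.≤ m ⊖ n ⇔ n < m
1≤⊖⇔< {m} {n} = mk⇔ to (λ n<m → subst (pos 1 ℤ.≤_) (sym (ℤP.⊖-≥ (<⇒≤ n<m))) (ℤ.+≤+ (m<n⇒0<n∸m n<m)))
  where
  1≰-+ : ∀ x → ¬ (pos 1 ℤ.≤ ℤ.- pos x)
  1≰-+ zero (ℤ.+≤+ ())
  1≰-+ (suc x) ()
  to : pos 1 ℤ.≤ m ⊖ n → n < m
  to 1≤m⊖n with n <? m
  ... | yes n<m = n<m
  ... | no n≮m = contradiction (subst (pos 1 ℤ.≤_) (ℤP.⊖-≤ (≮⇒≥ n≮m)) 1≤m⊖n) (1≰-+ (n ∸ m))

complete⇔ : ∀ {n} (α : Pref n) → Complete α ⇔ (∀ {j} → 2 ≤ j → j ≤ n → n ∸ j + 1 < numAtLeast α j)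
complete⇔ {n} α = mk⇔
  (λ complete {j} 2≤j j≤n →
     Equivalence.to 1≤⊖⇔< (subst (pos 1 ℤ.≤_) (u-as-⊖ α j≤n) (All.lookup complete (∈-range 2≤j j≤n))))
  (λ bounds → All.tabulate λ {j} j∈ → let 2≤j , j≤n = ∈-fromTo⁻ {n = n} j∈ in
     subst (pos 1 ℤ.≤_) (sym (u-as-⊖ α j≤n)) (Equivalence.from 1≤⊖⇔< (bounds 2≤j j≤n)))
  where
  ∈-range : ∀ {j} → 2 ≤ j → j ≤ n → j ∈ range2n n
  ∈-range {suc i} 2≤j i<n = ∈-fromTo⁺ 2≤j i<n

numAtLeast-map-suc+below : ∀ {M L} (β : Vec (Fin M) L) s → numAtLeast (Vec.map Fin.suc β) (suc (suc s)) + below β s ≡ L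
numAtLeast-map-suc+below {L = L} β s = begin
  numAtLeast (Vec.map Fin.suc β) (suc (suc s)) + below β s
    ≡⟨ cong (_+ below β s) (∑-toList-map Fin.suc β _) ⟩
  ∑[ y ∈ toList β ] 𝟙 (suc (suc s) ≤? suc (suc (toℕ y))) + below β s   ≡⟨ ∑-+ (toList β) _ _ ⟨
  ∑[ y ∈ toList β ] (𝟙 (suc (suc s) ≤? suc (suc (toℕ y))) + 𝟙 (toℕ y <? s)) ≡⟨ ∑-cong (toList β) (λ y → exactly-one (toℕ y)) ⟩
  ∑[ _ ∈ toList β ] 1                                                  ≡⟨ ∑-1 (toList β) ⟩
  length (toList β)                                                    ≡⟨ length-toList β ⟩
  L                                                                    ∎
  where
  open ≡-Reasoning
  exactly-one : ∀ y → 𝟙 (suc (suc s) ≤? suc (suc y)) + 𝟙 (y <? s) ≡ 1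
  exactly-one y with y <? s
  ... | yes y<s = cong (_+ 1) (𝟙-no (suc (suc s) ≤? suc (suc y)) λ 2+s≤2+y → <⇒≱ y<s (s≤s⁻¹ (s≤s⁻¹ 2+s≤2+y)))
  ... | no y≮s = cong (_+ 0) (𝟙-yes (suc (suc s) ≤? suc (suc y)) (s≤s (s≤s (≮⇒≥ y≮s))))

zero∈⇒¬complete : ∀ {m} (α : Pref (suc (suc m))) → Fin.zero ∈ᵥ α → ¬ Complete α
zero∈⇒¬complete {m} α zero∈α complete =
  <⇒≱ m+1<atLeast2 (subst (numAtLeast α 2 ≤_) (+-comm 1 m) (s≤s⁻¹ atLeast2<length))
  where
  m+1<atLeast2 : m + 1 < numAtLeast α 2
  m+1<atLeast2 = Equivalence.to (complete⇔ α) complete ≤-refl (s≤s (s≤s z≤n))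
  atLeast2<length : numAtLeast α 2 < suc (suc m)
  atLeast2<length = subst (numAtLeast α 2 <_) (length-toList α)
    (∑𝟙<length (λ x → 2 ≤? suc (toℕ x)) (∈-toList⁺ zero∈α) λ { (s≤s ()) })

complete-map-suc⇔fewBelow : ∀ {k} (β : Vec (Fin (suc k)) (suc (suc k))) → Complete (Vec.map Fin.suc β) ⇔ FewBelow β
complete-map-suc⇔fewBelow {k} β = mk⇔
  (λ complete {s} s<M → Equivalence.to (balance s<M) (Equivalence.to (complete⇔ α) complete (s≤s (s≤s z≤n)) (s≤s s<M)))
  (λ few → Equivalence.from (complete⇔ α) λ { {suc (suc s)} _ (s≤s s<M) → Equivalence.from (balance s<M) (few s<M)
                                           ; {suc zero} (s≤s ()) _ })
  where
  α : Pref (suc (suc k))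
  α = Vec.map Fin.suc β
  balance : ∀ {s} → s < suc k → suc k ∸ suc s + 1 < numAtLeast α (suc (suc s)) ⇔ below β s ≤ s
  balance {s} s<M = +≡+⇒≤⇔≤ (trans (numAtLeast-map-suc+below β s) (sym s+[M∸[1+s]+2]≡1+M))
    where
    regroup : ∀ s d → s + suc (d + 1) ≡ suc (suc s + d)
    regroup = solve-∀
    s+[M∸[1+s]+2]≡1+M : s + suc (suc k ∸ suc s + 1) ≡ suc (suc k)
    s+[M∸[1+s]+2]≡1+M = trans (regroup s (suc k ∸ suc s)) (cong suc (m+[n∸m]≡n s<M))

mainTheorem10 : (n : ℕ) → 2 ≤ n → numComplete n ≡ (n ∸ 1) ^ (n ∸ 1)
mainTheorem10 (suc (suc k)) _ = begin
  numComplete n                                           ≡⟨ length-filter≡∑𝟙 complete? (allVecs n n) ⟩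
  ∑ (allVecs n n) (𝟙 ∘ complete?)                         ≡⟨ ∑-allVecs-avoiding-zero M n (𝟙 ∘ complete?) no-zero ⟩
  ∑[ β ∈ allVecs M n ] 𝟙 (complete? (Vec.map Fin.suc β))  ≡⟨ ∑-cong (allVecs M n) shift ⟩
  ∑ (allVecs M n) (𝟙 ∘ fewBelow?)                         ≡⟨ count-fewBelow k ⟩
  M ^ M                                                   ∎
  where
  open ≡-Reasoning
  M n : ℕ
  M = suc k
  n = suc M
  no-zero : ∀ α → Fin.zero ∈ᵥ α → 𝟙 (complete? α) ≡ 0
  no-zero α zero∈α = 𝟙-no (complete? α) (zero∈⇒¬complete α zero∈α)
  shift : ∀ β → 𝟙 (complete? (Vec.map Fin.suc β)) ≡ 𝟙 (fewBelow? β)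
  shift β = 𝟙-cong (complete? (Vec.map Fin.suc β)) (fewBelow? β) (complete-map-suc⇔fewBelow β)

mainTheorem10 (suc zero) (s≤s ())
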